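{- Let $M$ be a loopless rank-$4$ hypermodular matroid. Then there do not exist two disjoint flats of $M$ of rank $3$ and $2$ respectively if and only if no rank-$3$ flat of $M$ contains two disjoint rank-$2$ flats.
   Context: A pair of flats $\{A,B\}$ is modular if $r(A\cup B)+r(A\cap B)=r(A)+r(B)$. A rank-$4$ matroid is hypermodular if every pair of two rank-$3$ flats is a modular pair. -}

module Defs where

open import Data.Nat using (ℕ; _≤_; _<_)
open import Data.Fin using (Fin)
open import Data.Fin.Subset using (Subset; _∈_; _∉_; _⊆_; _∪_; _∩_; ⁅_⁆; ∣_∣; ⊤; Empty)
open import Data.Product using (_×_; ∃-syntax)
open import Relation.Binary.PropositionalEquality using (_≡_)

record Matroid (n : ℕ) : Set where
  field
    r         : Subset n → ℕ
    r-bounded : ∀ X → r X ≤ ∣ X ∣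
    r-mono    : ∀ {X Y} → X ⊆ Y → r X ≤ r Y
    r-submod  : ∀ X Y → Data.Nat._+_ (r (X ∪ Y)) (r (X ∩ Y)) ≤ Data.Nat._+_ (r X) (r Y)

module _ {n : ℕ} (M : Matroid n) where
  open Matroid M

  rank : ℕ
  rank = r ⊤

  IsFlat : Subset n → Set
  IsFlat F = ∀ e → e ∉ F → r F < r (F ∪ ⁅ e ⁆)

  Loopless : Set
  Loopless = ∀ e → r ⁅ e ⁆ ≡ 1

  ModularPair : Subset n → Subset n → Set
  ModularPair A B = Data.Nat._+_ (r (A ∪ B)) (r (A ∩ B)) ≡ Data.Nat._+_ (r A) (r B)

  Hypermodular : Set
  Hypermodular = rank ≡ 4 ×
    (∀ A B → IsFlat A → IsFlat B → r A ≡ 3 → r B ≡ 3 → ModularPair A B)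

  Disjoint : Subset n → Subset n → Set
  Disjoint A B = Empty (A ∩ B)

  DisjointFlats32 : Set
  DisjointFlats32 = ∃[ A ] ∃[ B ]
    (IsFlat A × IsFlat B × r A ≡ 3 × r B ≡ 2 × Disjoint A B)

  PlaneWithDisjointLines : Set
  PlaneWithDisjointLines = ∃[ F ] ∃[ A ] ∃[ B ]
    (IsFlat F × r F ≡ 3 × IsFlat A × IsFlat B × r A ≡ 2 × r B ≡ 2 ×
     A ⊆ F × B ⊆ F × Disjoint A B)

{-# OPTIONS --safe #-}
-- A point e off a plane F spans, together with a line of F, a second plane P.
-- Since e ∈ P ∖ F the two planes span the whole rank-4 matroid, so by
-- hypermodularity they meet in a set of rank 2, which is the flat P ∩ F.
-- Starting from a plane F with disjoint lines A, B and taking P = cl(A ∪ e),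
-- the line A already fills P ∩ F, so P misses B. Conversely, from a plane P and
-- a line L disjoint from it, the plane F = cl(L ∪ p) for a point p ∈ P contains
-- the disjoint lines L and F ∩ P.
module Submission where

open import Defs
open import Data.Nat using (ℕ; suc; _≤_; _<_; _+_)
open import Data.Nat.Properties
open import Data.Product using (_×_; _,_; ∃-syntax; proj₁; proj₂)
open import Data.Sum using (_⊎_; inj₁; inj₂)
open import Data.Fin.Properties using (¬∀⟶∃¬)
open import Data.Fin.Subset using (Subset; Nonempty; _∈_; _∉_; _⊆_; _∪_; _∩_; ⁅_⁆; ∣_∣; ⊤; Empty)
open import Data.Fin.Subset.Properties
open import Data.List using (List; []; _∷_; allFin)
open import Data.List.Relation.Unary.All using (All; []; _∷_; lookup)
open import Data.List.Membership.Propositional.Properties using (∈-allFin)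
open import Relation.Nullary using (¬_; yes; no; contradiction; contraposition)
open import Relation.Binary.PropositionalEquality using (_≡_; refl; sym; trans; cong; cong₂; subst; subst₂; module ≡-Reasoning)

module SubsetLattice {n : ℕ} where

  ∪-lub : ∀ {A B C : Subset n} → A ⊆ C → B ⊆ C → A ∪ B ⊆ C
  ∪-lub {A} {B} A⊆C B⊆C x∈A∪B with x∈p∪q⁻ A B x∈A∪B
  ... | inj₁ x∈A = A⊆C x∈A
  ... | inj₂ x∈B = B⊆C x∈B

  ∩-glb : ∀ {A B C : Subset n} → C ⊆ A → C ⊆ B → C ⊆ A ∩ B
  ∩-glb C⊆A C⊆B x∈C = x∈p∩q⁺ (C⊆A x∈C , C⊆B x∈C)

  ∪-monoˡ-⊆ : ∀ {A B : Subset n} C → A ⊆ B → A ∪ C ⊆ B ∪ C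
  ∪-monoˡ-⊆ {B = B} C A⊆B = ∪-lub (λ x∈A → p⊆p∪q C (A⊆B x∈A)) (q⊆p∪q B C)

  x∈p⇒⁅x⁆⊆p : ∀ {x} {A : Subset n} → x ∈ A → ⁅ x ⁆ ⊆ A
  x∈p⇒⁅x⁆⊆p {A = A} x∈A y∈⁅x⁆ = subst (_∈ A) (sym (x∈⁅y⁆⇒x≡y _ y∈⁅x⁆)) x∈A

  Empty-∩⇒∉ : ∀ {x} {A B : Subset n} → Empty (A ∩ B) → x ∈ A → x ∉ B
  Empty-∩⇒∉ A∩B≡∅ x∈A x∈B = A∩B≡∅ (_ , x∈p∩q⁺ (x∈A , x∈B))

open SubsetLattice

module Flats {n : ℕ} (M : Matroid n) where
  open Matroid M

  r-∪-⁅⁆-≤ : ∀ X e → r (X ∪ ⁅ e ⁆) ≤ suc (r X)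
  r-∪-⁅⁆-≤ X e = begin
    r (X ∪ ⁅ e ⁆)    ≤⟨ m+n≤o⇒m≤o _ (r-submod X ⁅ e ⁆) ⟩
    r X + r ⁅ e ⁆    ≤⟨ +-monoʳ-≤ (r X) (r-bounded ⁅ e ⁆) ⟩
    r X + ∣ ⁅ e ⁆ ∣  ≡⟨ cong (r X +_) (∣⁅x⁆∣≡1 e) ⟩
    r X + 1          ≡⟨ +-comm (r X) 1 ⟩
    suc (r X)        ∎
    where open ≤-Reasoning

  r≡suc⇒Nonempty : ∀ {X k} → r X ≡ suc k → Nonempty X
  r≡suc⇒Nonempty {X} rX≡1+k with nonempty? X
  ... | yes X≢∅ = X≢∅
  ... | no X≡∅ = contradiction (subst (_≤ 0) rX≡1+k r≤0) λ ()
    where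
    r≤0 : r X ≤ 0
    r≤0 = ≤-trans (r-bounded X) (≤-reflexive (trans (cong ∣_∣ (Empty-unique X≡∅)) (∣⊥∣≡0 n)))

  r<rank⇒∃∉ : ∀ {X} → r X < rank M → ∃[ e ] e ∉ X
  r<rank⇒∃∉ {X} rX<rank = ¬∀⟶∃¬ n (_∈ X) (_∈? X) λ all∈X →
    <⇒≱ rX<rank (r-mono (λ {x} _ → all∈X x))

  r-∪-⁅⁆-submod : ∀ {S T} x → S ⊆ T → r (T ∪ ⁅ x ⁆) + r S ≤ r T + r (S ∪ ⁅ x ⁆)
  r-∪-⁅⁆-submod {S} {T} x S⊆T = begin
    r (T ∪ ⁅ x ⁆) + r S                          ≤⟨ +-mono-≤ (r-mono T∪x⊆) (r-mono S⊆) ⟩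
    r (T ∪ (S ∪ ⁅ x ⁆)) + r (T ∩ (S ∪ ⁅ x ⁆)) ≤⟨ r-submod T (S ∪ ⁅ x ⁆) ⟩
    r T + r (S ∪ ⁅ x ⁆)                          ∎
    where
    open ≤-Reasoning
    T∪x⊆ : T ∪ ⁅ x ⁆ ⊆ T ∪ (S ∪ ⁅ x ⁆)
    T∪x⊆ = ∪-lub (p⊆p∪q _) (λ y∈ → q⊆p∪q T _ (q⊆p∪q S _ y∈))
    S⊆ : S ⊆ T ∩ (S ∪ ⁅ x ⁆)
    S⊆ = ∩-glb S⊆T (p⊆p∪q ⁅ x ⁆)

  r-gain-antitone : ∀ {S T} x → S ⊆ T → r T < r (T ∪ ⁅ x ⁆) → r S < r (S ∪ ⁅ x ⁆)
  r-gain-antitone {S} {T} x S⊆T gainT = +-cancelˡ-< (r T) _ _ (begin-strict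
    r T + r S               <⟨ +-monoˡ-< (r S) gainT ⟩
    r (T ∪ ⁅ x ⁆) + r S     ≤⟨ r-∪-⁅⁆-submod x S⊆T ⟩
    r T + r (S ∪ ⁅ x ⁆)     ∎)
    where open ≤-Reasoning

  IsFlat-∩ : ∀ {F G} → IsFlat M F → IsFlat M G → IsFlat M (F ∩ G)
  IsFlat-∩ {F} {G} flatF flatG x x∉F∩G with x ∈? F
  ... | no x∉F  = r-gain-antitone x (p∩q⊆p F G) (flatF x x∉F)
  ... | yes x∈F = r-gain-antitone x (p∩q⊆q F G) (flatG x λ x∈G → x∉F∩G (x∈p∩q⁺ (x∈F , x∈G)))

  IsFlat⇒r-∪-⁅⁆ : ∀ {F x} → IsFlat M F → x ∉ F → r (F ∪ ⁅ x ⁆) ≡ suc (r F)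
  IsFlat⇒r-∪-⁅⁆ {F} {x} flatF x∉F = ≤-antisym (r-∪-⁅⁆-≤ F x) (flatF x x∉F)

  IsFlat⇒r-<-∪ : ∀ {F G x} → IsFlat M F → x ∉ F → x ∈ G → r F < r (F ∪ G)
  IsFlat⇒r-<-∪ {F} {G} flatF x∉F x∈G =
    <-≤-trans (flatF _ x∉F) (r-mono (∪-lub (p⊆p∪q G) (λ y∈ → q⊆p∪q F G (x∈p⇒⁅x⁆⊆p x∈G y∈))))

  IsFlat-⊇-r-≤⇒⊆ : ∀ {A X} → IsFlat M A → A ⊆ X → r X ≤ r A → X ⊆ A
  IsFlat-⊇-r-≤⇒⊆ {A} {X} flatA A⊆X rX≤rA {x} x∈X with x ∈? A
  ... | yes x∈A = x∈A
  ... | no x∉A  = contradiction rX≤rA (<⇒≱ (<-≤-trans (flatA x x∉A)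
                    (r-mono (∪-lub A⊆X (x∈p⇒⁅x⁆⊆p x∈X)))))

  saturate : ∀ Y (xs : List _) → ∃[ Y′ ] (Y ⊆ Y′ × r Y′ ≡ r Y ×
    All (λ x → x ∈ Y′ ⊎ r Y′ < r (Y′ ∪ ⁅ x ⁆)) xs)
  saturate Y [] = Y , (λ y∈ → y∈) , refl , []
  saturate Y (x ∷ xs) with r (Y ∪ ⁅ x ⁆) ≟ r Y
  ... | yes same with saturate (Y ∪ ⁅ x ⁆) xs
  ...   | Y′ , Y∪x⊆Y′ , rY′ , sat =
    Y′ , (λ y∈ → Y∪x⊆Y′ (p⊆p∪q ⁅ x ⁆ y∈)) , trans rY′ same ,
    inj₁ (Y∪x⊆Y′ (q⊆p∪q Y ⁅ x ⁆ (x∈⁅x⁆ x))) ∷ sat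
  saturate Y (x ∷ xs) | no grows with saturate Y xs
  ... | Y′ , Y⊆Y′ , rY′ , sat = Y′ , Y⊆Y′ , rY′ , inj₂ gain ∷ sat
    where
    open ≤-Reasoning
    gain : r Y′ < r (Y′ ∪ ⁅ x ⁆)
    gain = begin-strict
      r Y′            ≡⟨ rY′ ⟩
      r Y             <⟨ ≤∧≢⇒< (r-mono (p⊆p∪q ⁅ x ⁆)) (λ eq → grows (sym eq)) ⟩
      r (Y ∪ ⁅ x ⁆)   ≤⟨ r-mono (∪-monoˡ-⊆ ⁅ x ⁆ Y⊆Y′) ⟩
      r (Y′ ∪ ⁅ x ⁆)  ∎

  closure : ∀ Y → ∃[ F ] (IsFlat M F × Y ⊆ F × r F ≡ r Y)
  closure Y with saturate Y (allFin n)
  ... | F , Y⊆F , rF , sat = F , flatF , Y⊆F , rF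
    where
    flatF : IsFlat M F
    flatF e e∉F with lookup sat (∈-allFin e)
    ... | inj₁ e∈F = contradiction e∈F e∉F
    ... | inj₂ gain = gain

module HypermodularPlanes {n : ℕ} (M : Matroid n) (hypermodular : Hypermodular M) where
  open Matroid M
  open Flats M

  private
    rank≡4 : rank M ≡ 4
    rank≡4 = proj₁ hypermodular

  planes-meet-in-line : ∀ {F G x} → IsFlat M F → IsFlat M G → r F ≡ 3 → r G ≡ 3 →
    x ∉ F → x ∈ G → r (F ∩ G) ≡ 2
  planes-meet-in-line {F} {G} flatF flatG rF rG x∉F x∈G = +-cancelˡ-≡ 4 _ _ (begin
    4 + r (F ∩ G)          ≡⟨ cong (_+ r (F ∩ G)) (sym r-∪≡4) ⟩
    r (F ∪ G) + r (F ∩ G)  ≡⟨ proj₂ hypermodular F G flatF flatG rF rG ⟩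
    r F + r G              ≡⟨ cong₂ _+_ rF rG ⟩
    6                      ∎)
    where
    open ≡-Reasoning
    r-∪≡4 : r (F ∪ G) ≡ 4
    r-∪≡4 = ≤-antisym (subst (r (F ∪ G) ≤_) rank≡4 (r-mono ⊆⊤))
                      (subst (_< r (F ∪ G)) rF (IsFlat⇒r-<-∪ flatF x∉F x∈G))

  PlaneWithDisjointLines⇒DisjointFlats32 : PlaneWithDisjointLines M → DisjointFlats32 M
  PlaneWithDisjointLines⇒DisjointFlats32
    (F , A , B , flatF , rF , flatA , flatB , rA , rB , A⊆F , B⊆F , A∩B≡∅)
    with r<rank⇒∃∉ {F} (subst₂ _<_ (sym rF) (sym rank≡4) ≤-refl)
  ... | e , e∉F with closure (A ∪ ⁅ e ⁆)
  ... | P , flatP , A∪e⊆P , rP≡rA∪e = P , B , flatP , flatB , rP , rB , P∩B≡∅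
    where
    rP : r P ≡ 3
    rP = trans rP≡rA∪e (trans (IsFlat⇒r-∪-⁅⁆ flatA (λ e∈A → e∉F (A⊆F e∈A))) (cong suc rA))
    rF∩P : r (F ∩ P) ≡ 2
    rF∩P = planes-meet-in-line flatF flatP rF rP e∉F (A∪e⊆P (q⊆p∪q A ⁅ e ⁆ (x∈⁅x⁆ e)))
    F∩P⊆A : F ∩ P ⊆ A
    F∩P⊆A = IsFlat-⊇-r-≤⇒⊆ flatA (∩-glb A⊆F (λ x∈A → A∪e⊆P (p⊆p∪q ⁅ e ⁆ x∈A)))
      (≤-reflexive (trans rF∩P (sym rA)))
    P∩B≡∅ : Disjoint M P B
    P∩B≡∅ (x , x∈P∩B) with x∈p∩q⁻ P B x∈P∩B
    ... | x∈P , x∈B = Empty-∩⇒∉ A∩B≡∅ (F∩P⊆A (x∈p∩q⁺ (B⊆F x∈B , x∈P))) x∈B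

  DisjointFlats32⇒PlaneWithDisjointLines : DisjointFlats32 M → PlaneWithDisjointLines M
  DisjointFlats32⇒PlaneWithDisjointLines (P , L , flatP , flatL , rP , rL , P∩L≡∅)
    with r≡suc⇒Nonempty rP | r≡suc⇒Nonempty rL
  ... | p , p∈P | l , l∈L with closure (L ∪ ⁅ p ⁆)
  ... | F , flatF , L∪p⊆F , rF≡rL∪p =
    F , L , P ∩ F , flatF , rF , flatL , IsFlat-∩ flatP flatF , rL , rP∩F ,
    L⊆F , p∩q⊆q P F , L∩P∩F≡∅
    where
    L⊆F : L ⊆ F
    L⊆F x∈L = L∪p⊆F (p⊆p∪q ⁅ p ⁆ x∈L)
    rF : r F ≡ 3
    rF = trans rF≡rL∪p (trans (IsFlat⇒r-∪-⁅⁆ flatL (Empty-∩⇒∉ P∩L≡∅ p∈P)) (cong suc rL))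
    rP∩F : r (P ∩ F) ≡ 2
    rP∩F = planes-meet-in-line flatP flatF rP rF (λ l∈P → Empty-∩⇒∉ P∩L≡∅ l∈P l∈L) (L⊆F l∈L)
    L∩P∩F≡∅ : Disjoint M L (P ∩ F)
    L∩P∩F≡∅ (x , x∈L∩P∩F) with x∈p∩q⁻ L (P ∩ F) x∈L∩P∩F
    ... | x∈L , x∈P∩F = Empty-∩⇒∉ P∩L≡∅ (p∩q⊆p P F x∈P∩F) x∈L

proposition3p3 : ∀ (n : ℕ) (M : Matroid n) → Loopless M → rank M ≡ 4 → Hypermodular M →
    (¬ DisjointFlats32 M → ¬ PlaneWithDisjointLines M) × (¬ PlaneWithDisjointLines M → ¬ DisjointFlats32 M)
proposition3p3 n M _ _ hypermodular =
  contraposition PlaneWithDisjointLines⇒DisjointFlats32 ,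
  contraposition DisjointFlats32⇒PlaneWithDisjointLines
  where open HypermodularPlanes M hypermodular
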